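{- Let $\mathbf a=(a_n)_{n\ge1}$ be a strong divisibility sequence. Then for every positive integer $n$, $$\operatorname{lcm}(a_1,a_2,\dots,a_n)=\gcd\left\{\binom{n}{k}_{\mathbf a}\operatorname{lcm}(a_1,\dots,a_k)\ :\ k\in\mathbb{Z},\ n/2\le k\le n\right\}.$$
   Context: A sequence $(a_n)_{n\ge1}$ of positive integers is a strong divisibility sequence if $\gcd(a_n,a_m)=a_{\gcd(n,m)}$ for all positive integers $n,m$. For integers $0\le k\le n$, $\binom{n}{k}_{\mathbf a}:=\frac{a_na_{n-1}\cdots a_{n-k+1}}{a_1a_2\cdots a_k}$ (empty products equal $1$). -}

module Defs where

open import Data.Nat using (ℕ; zero; suc; _*_; _/_; _≤_; _≤?_)
open import Data.Nat.GCD using (gcd)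
open import Data.Nat.LCM using (lcm)
open import Relation.Nullary using (yes; no)

-- Sequences are functions ℕ → ℕ; only the values at indices ≥ 1 matter.

Positive : (ℕ → ℕ) → Set
Positive a = ∀ n → 1 ≤ n → 1 ≤ a n

StrongDivisibility : (ℕ → ℕ) → Set
StrongDivisibility a = ∀ n m → 1 ≤ n → 1 ≤ m → gcd (a n) (a m) ≡ a (gcd n m)
  where open import Relation.Binary.PropositionalEquality using (_≡_)

IsSDS : (ℕ → ℕ) → Set
IsSDS a = Positive a × StrongDivisibility a
  where open import Data.Product using (_×_)

fallingProd : (ℕ → ℕ) → ℕ → ℕ → ℕ
fallingProd a n zero    = 1
fallingProd a n (suc k) = a (n Data.Nat.∸ k) * fallingProd a n k
  where import Data.Nat

risingProd : (ℕ → ℕ) → ℕ → ℕ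
risingProd a zero    = 1
risingProd a (suc k) = risingProd a k * a (suc k)

-- natural-number division, with the (never used for SDS) convention x/0 = 0
divℕ : ℕ → ℕ → ℕ
divℕ x zero    = 0
divℕ x (suc d) = x / suc d

aBinom : (ℕ → ℕ) → ℕ → ℕ → ℕ
aBinom a n k = divℕ (fallingProd a n k) (risingProd a k)

lcmUpTo : (ℕ → ℕ) → ℕ → ℕ
lcmUpTo a zero    = 1
lcmUpTo a (suc k) = lcm (lcmUpTo a k) (a (suc k))

-- gcd of  aBinom a n k * lcmUpTo a k  over k ∈ {0,…,m} with n ≤ 2k (i.e. n/2 ≤ k)
-- (gcd of the empty set = 0, the identity for gcd)
gcdTerms : (ℕ → ℕ) → ℕ → ℕ → ℕ
gcdTerms a n zero with n ≤? 0
... | yes _ = aBinom a n 0 * lcmUpTo a 0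
... | no  _ = 0
gcdTerms a n (suc m) with n ≤? 2 * suc m
... | yes _ = gcd (gcdTerms a n m) (aBinom a n (suc m) * lcmUpTo a (suc m))
... | no  _ = gcdTerms a n m

gcdRHS : (ℕ → ℕ) → ℕ → ℕ
gcdRHS a n = gcdTerms a n n

-- If a_1 = … = a_n = 1 there is nothing to prove. Otherwise let r be least with
-- d = a_r > 1. Strong divisibility makes d divide a_j when r ∣ j and be coprime to a_j
-- otherwise, so dividing those a_j by d gives a strong divisibility sequence b with a
-- smaller product a_1 ⋯ a_n. Passing from b back to a multiplies a_1 ⋯ a_m by d^⌊m/r⌋
-- and lcm(a_1, …, a_m) by d^[r ≤ m]. Since ⌊k/r⌋ + ⌊(n−k)/r⌋ ≤ ⌊n/r⌋, and both terms
-- vanish when r > k ≥ n − k, induction on the product gives, for n/2 ≤ k ≤ n,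
--   lcm(a_1..a_n) · (a_1 ⋯ a_k) · (a_1 ⋯ a_{n−k})  ∣  (a_1 ⋯ a_n) · lcm(a_1..a_k).
-- Cancelling denominators, lcm(a_1..a_n) divides every term of the gcd, and the term
-- k = n is lcm(a_1..a_n) itself.
module Submission where

open import Defs
open import Data.Nat using (ℕ; _≤_)
open import Relation.Binary.PropositionalEquality using (_≡_)

open import Data.Nat
open import Data.Nat.Properties
open import Data.Nat.Divisibility
open import Data.Nat.DivMod using (m*[n/m]≡n; m/n*n≡m; n/n≡1)
open import Data.Nat.GCD
open import Data.Nat.LCM
open import Data.Nat.Coprimality as Coprimality using (Coprime; coprime-divisor)
open import Data.Nat.Induction using (<-wellFounded)
open import Data.Product using (∃-syntax; _×_; _,_; proj₁; proj₂)
open import Data.Sum using (_⊎_; inj₁; inj₂)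
open import Data.Nat.Tactic.RingSolver using (solve-∀)
open import Function using (_∘_)
open import Induction.WellFounded using (Acc; acc)
open import Relation.Nullary using (Dec; yes; no; ¬_; contradiction)
open import Relation.Nullary.Decidable using (_×-dec_)
open import Relation.Unary using (Decidable)
open import Relation.Binary.PropositionalEquality
  using (refl; sym; trans; cong; cong₂; subst; subst₂; module ≡-Reasoning)

𝟙 : ∀ {A : Set} → Dec A → ℕ
𝟙 (yes _) = 1
𝟙 (no _)  = 0

𝟙-yes : ∀ {A : Set} (d : Dec A) → A → 𝟙 d ≡ 1
𝟙-yes (yes _) _ = refl
𝟙-yes (no ¬a) a = contradiction a ¬a

multiples : ℕ → ℕ → ℕ
multiples r zero    = 0
multiples r (suc m) = 𝟙 (r ∣? suc m) + multiples r m

multiples-floor : ∀ {r} m → 1 ≤ r → multiples r m * r ≤ m × m < suc (multiples r m) * r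
multiples-floor zero    1≤r = z≤n , ≤-trans 1≤r (m≤m+n _ 0)
multiples-floor {r} (suc m) 1≤r with r ∣? suc m | multiples-floor m 1≤r
... | yes (divides q sm≡qr) | lower , upper =
  ≤-reflexive (sym sm≡cr) , subst (_< suc (suc c) * r) (sym sm≡cr) (m<n+m _ 1≤r)
  where
  c = multiples r m
  c<q : c < q
  c<q = *-cancelʳ-< r c q (≤-<-trans lower (subst (m <_) sm≡qr ≤-refl))
  sm≡cr : suc m ≡ suc c * r
  sm≡cr = ≤-antisym upper (subst (suc c * r ≤_) (sym sm≡qr) (*-monoˡ-≤ r c<q))
... | no r∤sm | lower , upper =
  m≤n⇒m≤1+n lower , ≤∧≢⇒< upper (r∤sm ∘ divides (suc (multiples r m)))

multiples-superadditive : ∀ {r} x y → 1 ≤ r → multiples r x + multiples r y ≤ multiples r (x + y)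
multiples-superadditive {r} x y 1≤r = s≤s⁻¹ (*-cancelʳ-< r _ _ (begin-strict
  (multiples r x + multiples r y) * r   ≡⟨ *-distribʳ-+ r (multiples r x) (multiples r y) ⟩
  multiples r x * r + multiples r y * r ≤⟨ +-mono-≤ (proj₁ (floor x)) (proj₁ (floor y)) ⟩
  x + y                                 <⟨ proj₂ (floor (x + y)) ⟩
  suc (multiples r (x + y)) * r         ∎))
  where
  open ≤-Reasoning
  floor = λ m → multiples-floor m 1≤r

multiples-below : ∀ {r m} → 1 ≤ r → m < r → multiples r m ≡ 0
multiples-below {r} {m} 1≤r m<r with multiples r m | multiples-floor m 1≤r
... | zero  | _         = refl
... | suc c | lower , _ = contradiction (≤-trans (m≤m+n r (c * r)) lower) (<⇒≱ m<r)

𝟙[≤]≤multiples : ∀ {r} m → 1 ≤ r → 𝟙 (r ≤? m) ≤ multiples r m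
𝟙[≤]≤multiples {r} m 1≤r with r ≤? m
... | no _ = z≤n
... | yes r≤m with multiples r m | multiples-floor m 1≤r
...   | zero  | _ , upper = contradiction (≤-trans (≤-reflexive (+-identityʳ r)) r≤m) (<⇒≱ upper)
...   | suc _ | _         = s≤s z≤n

-- Compares the powers of d = a r gained by the two sides of CrossDivides in one descent step.
exponent-inequality : ∀ {r n k} → 1 ≤ r → k ≤ n → n ∸ k ≤ k →
  𝟙 (r ≤? n) + (multiples r k + multiples r (n ∸ k)) ≤ multiples r n + 𝟙 (r ≤? k)
exponent-inequality {r} {n} {k} 1≤r k≤n n∸k≤k with r ≤? k
... | yes r≤k = begin
  𝟙 (r ≤? n) + (multiples r k + multiples r (n ∸ k))
    ≡⟨ cong (_+ (multiples r k + multiples r (n ∸ k))) (𝟙-yes (r ≤? n) (≤-trans r≤k k≤n)) ⟩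
  suc (multiples r k + multiples r (n ∸ k))
    ≤⟨ s≤s (multiples-superadditive k (n ∸ k) 1≤r) ⟩
  suc (multiples r (k + (n ∸ k)))
    ≡⟨ cong (suc ∘ multiples r) (m+[n∸m]≡n k≤n) ⟩
  suc (multiples r n)
    ≡⟨ +-comm 1 (multiples r n) ⟩
  multiples r n + 1 ∎
  where open ≤-Reasoning
... | no r≰k = begin
  𝟙 (r ≤? n) + (multiples r k + multiples r (n ∸ k))
    ≡⟨ cong₂ (λ x y → 𝟙 (r ≤? n) + (x + y)) (multiples-below 1≤r k<r)
                                             (multiples-below 1≤r (≤-<-trans n∸k≤k k<r)) ⟩
  𝟙 (r ≤? n) + 0
    ≤⟨ +-monoˡ-≤ 0 (𝟙[≤]≤multiples n 1≤r) ⟩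
  multiples r n + 0 ∎
  where
  open ≤-Reasoning
  k<r = ≰⇒> r≰k

gcd-*-coprime : ∀ {c} x y → Coprime c y → gcd (c * x) y ≡ gcd x y
gcd-*-coprime {c} x y c⊥y = ∣-antisym
  (gcd-greatest (coprime-divisor g⊥c (gcd[m,n]∣m (c * x) y)) (gcd[m,n]∣n (c * x) y))
  (gcd-greatest (∣-trans (gcd[m,n]∣m x y) (n∣m*n c)) (gcd[m,n]∣n x y))
  where
  g⊥c : Coprime (gcd (c * x) y) c
  g⊥c (d∣g , d∣c) = c⊥y (d∣c , ∣-trans d∣g (gcd[m,n]∣n (c * x) y))

*-lcm-∣ : ∀ c {x y} z .{{_ : NonZero c}} → c ∣ z → x ∣ z / c → y ∣ z / c → c * lcm x y ∣ z
*-lcm-∣ c {x} {y} z c∣z x∣q y∣q =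
  subst (c * lcm x y ∣_) (m*[n/m]≡n c∣z) (*-monoʳ-∣ c (lcm-least x∣q y∣q))

c*lcm[m,n]≡lcm[cm,cn] : ∀ c m n .{{_ : NonZero c}} → c * lcm m n ≡ lcm (c * m) (c * n)
c*lcm[m,n]≡lcm[cm,cn] c m n = ∣-antisym
  (*-lcm-∣ c L c∣L (∣q (m∣lcm[m,n] (c * m) (c * n))) (∣q (n∣lcm[m,n] (c * m) (c * n))))
  (lcm-least (*-monoʳ-∣ c (m∣lcm[m,n] m n)) (*-monoʳ-∣ c (n∣lcm[m,n] m n)))
  where
  L = lcm (c * m) (c * n)
  c∣L : c ∣ L
  c∣L = ∣-trans (m∣m*n m) (m∣lcm[m,n] (c * m) (c * n))
  ∣q : ∀ {w} → c * w ∣ L → w ∣ L / c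
  ∣q c*w∣L = *-cancelˡ-∣ c (subst (c * _ ∣_) (sym (m*[n/m]≡n c∣L)) c*w∣L)

lcm-*-coprime : ∀ {c} x y .{{_ : NonZero c}} → Coprime c y → lcm (c * x) y ≡ c * lcm x y
lcm-*-coprime {c} x y c⊥y = ∣-antisym
  (lcm-least (*-monoʳ-∣ c (m∣lcm[m,n] x y)) (∣-trans (n∣lcm[m,n] x y) (n∣m*n c)))
  (*-lcm-∣ c L c∣L
    (*-cancelˡ-∣ c (subst (c * x ∣_) (sym c*q≡L) (m∣lcm[m,n] (c * x) y)))
    (coprime-divisor (Coprimality.sym c⊥y) (subst (y ∣_) (sym c*q≡L) (n∣lcm[m,n] (c * x) y))))
  where
  L = lcm (c * x) y
  c∣L : c ∣ L
  c∣L = ∣-trans (m∣m*n x) (m∣lcm[m,n] (c * x) y)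
  c*q≡L : c * (L / c) ≡ L
  c*q≡L = m*[n/m]≡n c∣L

m∣n⇒gcd[m,n]≡m : ∀ {m n} → m ∣ n → gcd m n ≡ m
m∣n⇒gcd[m,n]≡m {m} {n} m∣n = ∣-antisym (gcd[m,n]∣m m n) (gcd-greatest ∣-refl m∣n)

lcm[1,n]≡n : ∀ n → lcm 1 n ≡ n
lcm[1,n]≡n n = ∣-antisym (lcm-least (1∣ n) ∣-refl) (n∣lcm[m,n] 1 n)

^-*-interchange : ∀ d i j x y → d ^ i * x * (d ^ j * y) ≡ d ^ (i + j) * (x * y)
^-*-interchange d i j x y rewrite ^-distribˡ-+-* d i j = solve-∀′ (d ^ i) (d ^ j) x y
  where
  solve-∀′ : ∀ u v x y → u * x * (v * y) ≡ u * v * (x * y)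
  solve-∀′ = solve-∀

^-monoʳ-∣ : ∀ d {i j} → i ≤ j → d ^ i ∣ d ^ j
^-monoʳ-∣ d {i} {j} i≤j = divides (d ^ (j ∸ i)) (begin
  d ^ j               ≡⟨ cong (d ^_) (sym (m∸n+n≡m i≤j)) ⟩
  d ^ (j ∸ i + i)     ≡⟨ ^-distribˡ-+-* d (j ∸ i) i ⟩
  d ^ (j ∸ i) * d ^ i ∎)
  where open ≡-Reasoning

least-or-none : ∀ {P : ℕ → Set} → Decidable P → ∀ n →
  (∀ j → j ≤ n → ¬ P j) ⊎ ∃[ r ] r ≤ n × P r × (∀ j → j < r → ¬ P j)
least-or-none P? zero with P? 0
... | yes P0 = inj₂ (0 , z≤n , P0 , λ _ ())
... | no ¬P0 = inj₁ λ { zero z≤n → ¬P0 }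
least-or-none {P} P? (suc n) with least-or-none P? n
... | inj₂ (r , r≤n , Pr , least) = inj₂ (r , m≤n⇒m≤1+n r≤n , Pr , least)
... | inj₁ none with P? (suc n)
...   | yes P1+n = inj₂ (suc n , ≤-refl , P1+n , λ j j<1+n → none j (s≤s⁻¹ j<1+n))
...   | no ¬P1+n = inj₁ λ j j≤1+n → ¬P-below (m≤n⇒m<n∨m≡n j≤1+n)
  where
  ¬P-below : ∀ {j} → j < suc n ⊎ j ≡ suc n → ¬ P j
  ¬P-below (inj₁ j<1+n) = none _ (s≤s⁻¹ j<1+n)
  ¬P-below (inj₂ refl)  = ¬P1+n

risingProd-pos : ∀ {a} → Positive a → ∀ m → 1 ≤ risingProd a m
risingProd-pos pos zero    = s≤s z≤n
risingProd-pos pos (suc m) = *-mono-≤ (risingProd-pos pos m) (pos (suc m) (s≤s z≤n))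

lcmUpTo-∣-risingProd : ∀ a m → lcmUpTo a m ∣ risingProd a m
lcmUpTo-∣-risingProd a zero    = ∣-refl
lcmUpTo-∣-risingProd a (suc m) =
  lcm-least (∣m⇒∣m*n (a (suc m)) (lcmUpTo-∣-risingProd a m)) (n∣m*n (risingProd a m))

lcmUpTo-pos : ∀ {a} → Positive a → ∀ m → 1 ≤ lcmUpTo a m
lcmUpTo-pos {a} pos m = n≢0⇒n>0 λ L≡0 → <⇒≢ (risingProd-pos pos m)
  (sym (0∣⇒≡0 (subst (_∣ risingProd a m) L≡0 (lcmUpTo-∣-risingProd a m))))

lcmUpTo-mono-∣ : ∀ a {m n} → m ≤ n → lcmUpTo a m ∣ lcmUpTo a n
lcmUpTo-mono-∣ a {n = zero} z≤n = ∣-refl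
lcmUpTo-mono-∣ a {n = suc n} m≤1+n with m≤n⇒m<n∨m≡n m≤1+n
... | inj₁ m<1+n = ∣-trans (lcmUpTo-mono-∣ a (s≤s⁻¹ m<1+n)) (m∣lcm[m,n] (lcmUpTo a n) (a (suc n)))
... | inj₂ refl  = ∣-refl

OnesUpTo : (ℕ → ℕ) → ℕ → Set
OnesUpTo a n = ∀ j → 1 ≤ j → j ≤ n → a j ≡ 1

¬>1⇒≡1 : ∀ {a j} → Positive a → 1 ≤ j → ¬ (1 ≤ j × 1 < a j) → a j ≡ 1
¬>1⇒≡1 pos 1≤j ¬>1 = ≤-antisym (≮⇒≥ (¬>1 ∘ (1≤j ,_))) (pos _ 1≤j)

OnesUpTo-≤ : ∀ {a m n} → m ≤ n → OnesUpTo a n → OnesUpTo a m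
OnesUpTo-≤ m≤n ones j 1≤j j≤m = ones j 1≤j (≤-trans j≤m m≤n)

risingProd-ones : ∀ {a} n → OnesUpTo a n → risingProd a n ≡ 1
risingProd-ones zero    ones = refl
risingProd-ones (suc n) ones = cong₂ _*_
  (risingProd-ones n (OnesUpTo-≤ (n≤1+n n) ones)) (ones (suc n) (s≤s z≤n) ≤-refl)

lcmUpTo-ones : ∀ {a} n → OnesUpTo a n → lcmUpTo a n ≡ 1
lcmUpTo-ones zero    ones = refl
lcmUpTo-ones (suc n) ones = trans
  (cong₂ lcm (lcmUpTo-ones n (OnesUpTo-≤ (n≤1+n n) ones)) (ones (suc n) (s≤s z≤n) ≤-refl))
  (lcm[1,n]≡n 1)

fallingProd*risingProd : ∀ a {n k} → k ≤ n → fallingProd a n k * risingProd a (n ∸ k) ≡ risingProd a n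
fallingProd*risingProd a {n} {zero} _ = *-identityˡ (risingProd a n)
fallingProd*risingProd a {suc n} {suc k} (s≤s k≤n) = begin
  a (suc n ∸ k) * F * risingProd a (n ∸ k)   ≡⟨ cong (λ i → a i * F * risingProd a (n ∸ k)) 1+n∸k ⟩
  a (suc (n ∸ k)) * F * risingProd a (n ∸ k) ≡⟨ rearrange (a (suc (n ∸ k))) F (risingProd a (n ∸ k)) ⟩
  F * risingProd a (suc (n ∸ k))             ≡⟨ cong (λ i → F * risingProd a i) (sym 1+n∸k) ⟩
  F * risingProd a (suc n ∸ k)               ≡⟨ fallingProd*risingProd a (m≤n⇒m≤1+n k≤n) ⟩
  risingProd a (suc n)                       ∎
  where
  open ≡-Reasoning
  F = fallingProd a (suc n) k
  1+n∸k : suc n ∸ k ≡ suc (n ∸ k)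
  1+n∸k = +-∸-assoc 1 k≤n
  rearrange : ∀ x f r → x * f * r ≡ f * (r * x)
  rearrange = solve-∀

module DivideOut {a : ℕ → ℕ} (sds : IsSDS a) {r : ℕ} (1≤r : 1 ≤ r) (1<d : 1 < a r)
                 (ones-below : ∀ j → 1 ≤ j → j < r → a j ≡ 1) where

  d : ℕ
  d = a r

  instance
    d≢0 : NonZero d
    d≢0 = >-nonZero (<-trans z<s 1<d)

  private
    pos = proj₁ sds
    sd  = proj₂ sds

    1≤gcd : ∀ {i} j → 1 ≤ i → 1 ≤ gcd i j
    1≤gcd {i} j 1≤i = n≢0⇒n>0 (gcd[m,n]≢0 i j (inj₁ (m<n⇒n≢0 1≤i)))

  d∣a : ∀ {j} → 1 ≤ j → r ∣ j → d ∣ a j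
  d∣a {j} 1≤j r∣j =
    subst (_∣ a j) (trans (sd r j 1≤r 1≤j) (cong a (m∣n⇒gcd[m,n]≡m r∣j))) (gcd[m,n]∣n d (a j))

  -- gcd (a r) (a j) = a (gcd r j), and gcd r j is a proper divisor of r.
  d⊥a : ∀ {j} → 1 ≤ j → ¬ r ∣ j → Coprime d (a j)
  d⊥a {j} 1≤j r∤j =
    Coprimality.gcd≡1⇒coprime (trans (sd r j 1≤r 1≤j) (ones-below g (1≤gcd j 1≤r) g<r))
    where
    g = gcd r j
    g<r : g < r
    g<r = ≤∧≢⇒< (∣⇒≤ {{>-nonZero 1≤r}} (gcd[m,n]∣m r j))
                λ g≡r → r∤j (subst (_∣ j) g≡r (gcd[m,n]∣n r j))

  b : ℕ → ℕ
  b j with r ∣? j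
  ... | yes _ = a j / d
  ... | no  _ = a j

  a≡d*b : ∀ {j} → 1 ≤ j → r ∣ j → a j ≡ d * b j
  a≡d*b {j} 1≤j r∣j with r ∣? j
  ... | yes _  = sym (m*[n/m]≡n (d∣a 1≤j r∣j))
  ... | no r∤j = contradiction r∣j r∤j

  a≡b : ∀ {j} → ¬ r ∣ j → a j ≡ b j
  a≡b {j} r∤j with r ∣? j
  ... | yes r∣j = contradiction r∣j r∤j
  ... | no _    = refl

  a≡d^𝟙*b : ∀ {j} → 1 ≤ j → a j ≡ d ^ 𝟙 (r ∣? j) * b j
  a≡d^𝟙*b {j} 1≤j with r ∣? j
  ... | yes r∣j = trans (sym (m*[n/m]≡n (d∣a 1≤j r∣j))) (cong (_* (a j / d)) (sym (*-identityʳ d)))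
  ... | no _    = sym (*-identityˡ (a j))

  b-positive : Positive b
  b-positive j 1≤j = n≢0⇒n>0 λ bj≡0 → m<n⇒n≢0 (pos j 1≤j)
    (trans (a≡d^𝟙*b 1≤j) (trans (cong (d ^ 𝟙 (r ∣? j) *_) bj≡0) (*-zeroʳ (d ^ 𝟙 (r ∣? j)))))

  b-gcd-mixed : ∀ {i j} → 1 ≤ i → 1 ≤ j → r ∣ i → ¬ r ∣ j → gcd (b i) (b j) ≡ b (gcd i j)
  b-gcd-mixed {i} {j} 1≤i 1≤j r∣i r∤j = begin
    gcd (b i) (b j)     ≡⟨ cong (gcd (b i)) (sym (a≡b r∤j)) ⟩
    gcd (b i) (a j)     ≡⟨ sym (gcd-*-coprime (b i) (a j) (d⊥a 1≤j r∤j)) ⟩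
    gcd (d * b i) (a j) ≡⟨ cong (λ x → gcd x (a j)) (sym (a≡d*b 1≤i r∣i)) ⟩
    gcd (a i) (a j)     ≡⟨ sd i j 1≤i 1≤j ⟩
    a (gcd i j)         ≡⟨ a≡b (r∤j ∘ λ r∣g → ∣-trans r∣g (gcd[m,n]∣n i j)) ⟩
    b (gcd i j)         ∎
    where open ≡-Reasoning

  b-strongDivisibility : StrongDivisibility b
  b-strongDivisibility i j 1≤i 1≤j = by-cases (r ∣? i) (r ∣? j)
    where
    open ≡-Reasoning
    by-cases : Dec (r ∣ i) → Dec (r ∣ j) → gcd (b i) (b j) ≡ b (gcd i j)
    by-cases (yes r∣i) (yes r∣j) = *-cancelˡ-≡ _ _ d (begin
      d * gcd (b i) (b j)     ≡⟨ c*gcd[m,n]≡gcd[cm,cn] d (b i) (b j) ⟩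
      gcd (d * b i) (d * b j) ≡⟨ sym (cong₂ gcd (a≡d*b 1≤i r∣i) (a≡d*b 1≤j r∣j)) ⟩
      gcd (a i) (a j)         ≡⟨ sd i j 1≤i 1≤j ⟩
      a (gcd i j)             ≡⟨ a≡d*b (1≤gcd j 1≤i) (gcd-greatest r∣i r∣j) ⟩
      d * b (gcd i j)         ∎)
    by-cases (yes r∣i) (no r∤j) = b-gcd-mixed 1≤i 1≤j r∣i r∤j
    by-cases (no r∤i) (yes r∣j) = begin
      gcd (b i) (b j) ≡⟨ gcd-comm (b i) (b j) ⟩
      gcd (b j) (b i) ≡⟨ b-gcd-mixed 1≤j 1≤i r∣j r∤i ⟩
      b (gcd j i)     ≡⟨ cong b (gcd-comm j i) ⟩
      b (gcd i j)     ∎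
    by-cases (no r∤i) (no r∤j) = begin
      gcd (b i) (b j) ≡⟨ sym (cong₂ gcd (a≡b r∤i) (a≡b r∤j)) ⟩
      gcd (a i) (a j) ≡⟨ sd i j 1≤i 1≤j ⟩
      a (gcd i j)     ≡⟨ a≡b (r∤i ∘ λ r∣g → ∣-trans r∣g (gcd[m,n]∣m i j)) ⟩
      b (gcd i j)     ∎

  b-IsSDS : IsSDS b
  b-IsSDS = b-positive , b-strongDivisibility

  risingProd-divideOut : ∀ m → risingProd a m ≡ d ^ multiples r m * risingProd b m
  risingProd-divideOut zero    = refl
  risingProd-divideOut (suc m) = begin
    risingProd a m * a (suc m)              ≡⟨ cong₂ _*_ (risingProd-divideOut m) (a≡d^𝟙*b (s≤s z≤n)) ⟩
    d ^ c * risingProd b m * (d ^ e * b (suc m)) ≡⟨ ^-*-interchange d c e (risingProd b m) (b (suc m)) ⟩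
    d ^ (c + e) * risingProd b (suc m)       ≡⟨ cong (λ x → d ^ x * risingProd b (suc m)) (+-comm c e) ⟩
    d ^ multiples r (suc m) * risingProd b (suc m) ∎
    where
    open ≡-Reasoning
    c = multiples r m
    e = 𝟙 (r ∣? suc m)

  a-ones-below : ∀ {m} → m < r → OnesUpTo a m
  a-ones-below m<r j 1≤j j≤m = ones-below j 1≤j (≤-<-trans j≤m m<r)

  b-ones-below : ∀ {m} → m < r → OnesUpTo b m
  b-ones-below m<r j 1≤j j≤m =
    trans (sym (a≡b (>⇒∤ {{>-nonZero 1≤j}} (≤-<-trans j≤m m<r)))) (a-ones-below m<r j 1≤j j≤m)

  lcmUpTo-above : ∀ {m} → r ≤ m → lcmUpTo a m ≡ d * lcmUpTo b m
  lcmUpTo-above {zero}  r≤0   = contradiction r≤0 (<⇒≱ 1≤r)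
  lcmUpTo-above {suc m} r≤1+m with r ≤? m
  ... | yes r≤m = trans (cong (λ x → lcm x (a (suc m))) (lcmUpTo-above r≤m)) (new-term (r ∣? suc m))
    where
    new-term : Dec (r ∣ suc m) → lcm (d * lcmUpTo b m) (a (suc m)) ≡ d * lcmUpTo b (suc m)
    new-term (yes r∣1+m) = trans (cong (lcm (d * lcmUpTo b m)) (a≡d*b (s≤s z≤n) r∣1+m))
      (sym (c*lcm[m,n]≡lcm[cm,cn] d (lcmUpTo b m) (b (suc m))))
    new-term (no r∤1+m)  = trans (cong (lcm (d * lcmUpTo b m)) (a≡b r∤1+m))
      (lcm-*-coprime (lcmUpTo b m) (b (suc m)) (subst (Coprime d) (a≡b r∤1+m) (d⊥a (s≤s z≤n) r∤1+m)))
  ... | no r≰m = begin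
    lcm (lcmUpTo a m) (a (suc m)) ≡⟨ cong₂ lcm (lcmUpTo-ones m (a-ones-below m<r)) (a≡d*b (s≤s z≤n) r∣1+m) ⟩
    lcm 1 (d * b (suc m))         ≡⟨ lcm[1,n]≡n (d * b (suc m)) ⟩
    d * b (suc m)                 ≡⟨ cong (d *_) (sym (lcm[1,n]≡n (b (suc m)))) ⟩
    d * lcm 1 (b (suc m))         ≡⟨ cong (λ x → d * lcm x (b (suc m))) (sym (lcmUpTo-ones m (b-ones-below m<r))) ⟩
    d * lcmUpTo b (suc m)         ∎
    where
    open ≡-Reasoning
    m<r = ≰⇒> r≰m
    r∣1+m : r ∣ suc m
    r∣1+m = subst (r ∣_) (≤-antisym r≤1+m m<r) ∣-refl

  lcmUpTo-divideOut : ∀ m → lcmUpTo a m ≡ d ^ 𝟙 (r ≤? m) * lcmUpTo b m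
  lcmUpTo-divideOut m with r ≤? m
  ... | yes r≤m = trans (lcmUpTo-above r≤m) (cong (_* lcmUpTo b m) (sym (*-identityʳ d)))
  ... | no r≰m  = trans (lcmUpTo-ones m (a-ones-below m<r))
                    (sym (trans (*-identityˡ (lcmUpTo b m)) (lcmUpTo-ones m (b-ones-below m<r))))
    where m<r = ≰⇒> r≰m

  risingProd-decreases : ∀ {n} → r ≤ n → risingProd b n < risingProd a n
  risingProd-decreases {n} r≤n = begin-strict
    risingProd b n                        <⟨ m<m*n (risingProd b n) (d ^ c) 1<d^c ⟩
    risingProd b n * d ^ c                ≡⟨ *-comm (risingProd b n) (d ^ c) ⟩
    d ^ c * risingProd b n                ≡⟨ sym (risingProd-divideOut n) ⟩
    risingProd a n                        ∎
    where
    open ≤-Reasoning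
    instance _ = >-nonZero (risingProd-pos b-positive n)
    c = multiples r n
    1<d^c : 1 < d ^ c
    1<d^c = ^-monoʳ-< d 1<d (subst (_≤ c) (𝟙-yes (r ≤? n) r≤n) (𝟙[≤]≤multiples n 1≤r))

-- With R = risingProd a and L = lcmUpTo a this is lcm(a_1..a_n) ∣ binom(n,k)_a · lcm(a_1..a_k)
-- multiplied through by the denominator (a_1 ⋯ a_k)(a_1 ⋯ a_{n−k}).
CrossDivides : (R L : ℕ → ℕ) → ℕ → ℕ → Set
CrossDivides R L n k = L n * (R k * R (n ∸ k)) ∣ R n * L k

CrossDivides-scale : ∀ d {R L R′ L′ : ℕ → ℕ} (c e : ℕ → ℕ) {n k} →
  (∀ m → R m ≡ d ^ c m * R′ m) → (∀ m → L m ≡ d ^ e m * L′ m) →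
  e n + (c k + c (n ∸ k)) ≤ c n + e k →
  CrossDivides R′ L′ n k → CrossDivides R L n k
CrossDivides-scale d {R} {L} {R′} {L′} c e {n} {k} R≡ L≡ exponents R′L′∣ =
  subst₂ _∣_ (sym lhs) (sym rhs) (*-pres-∣ (^-monoʳ-∣ d exponents) R′L′∣)
  where
  open ≡-Reasoning
  lhs : L n * (R k * R (n ∸ k)) ≡ d ^ (e n + (c k + c (n ∸ k))) * (L′ n * (R′ k * R′ (n ∸ k)))
  lhs = begin
    L n * (R k * R (n ∸ k))
      ≡⟨ cong₂ _*_ (L≡ n) (cong₂ _*_ (R≡ k) (R≡ (n ∸ k))) ⟩
    d ^ e n * L′ n * (d ^ c k * R′ k * (d ^ c (n ∸ k) * R′ (n ∸ k)))
      ≡⟨ cong (d ^ e n * L′ n *_) (^-*-interchange d (c k) (c (n ∸ k)) (R′ k) (R′ (n ∸ k))) ⟩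
    d ^ e n * L′ n * (d ^ (c k + c (n ∸ k)) * (R′ k * R′ (n ∸ k)))
      ≡⟨ ^-*-interchange d (e n) (c k + c (n ∸ k)) (L′ n) (R′ k * R′ (n ∸ k)) ⟩
    d ^ (e n + (c k + c (n ∸ k))) * (L′ n * (R′ k * R′ (n ∸ k))) ∎
  rhs : R n * L k ≡ d ^ (c n + e k) * (R′ n * L′ k)
  rhs = trans (cong₂ _*_ (R≡ n) (L≡ k)) (^-*-interchange d (c n) (e k) (R′ n) (L′ k))

IsSDS⇒CrossDivides : ∀ {n k} → k ≤ n → n ∸ k ≤ k → ∀ {a} → IsSDS a →
  CrossDivides (risingProd a) (lcmUpTo a) n k
IsSDS⇒CrossDivides {n} {k} k≤n n∸k≤k sds = descent sds (<-wellFounded _)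
  where
  all-ones : ∀ {a} → OnesUpTo a n → CrossDivides (risingProd a) (lcmUpTo a) n k
  all-ones ones
    rewrite lcmUpTo-ones n ones
          | risingProd-ones k (OnesUpTo-≤ k≤n ones)
          | risingProd-ones (n ∸ k) (OnesUpTo-≤ (m∸n≤m n k) ones)
          | risingProd-ones n ones
          | lcmUpTo-ones k (OnesUpTo-≤ k≤n ones) = ∣-refl

  descent : ∀ {a} → IsSDS a → Acc _<_ (risingProd a n) → CrossDivides (risingProd a) (lcmUpTo a) n k
  descent {a} sds (acc smaller) with least-or-none (λ j → (1 ≤? j) ×-dec (1 <? a j)) n
  ... | inj₁ none = all-ones λ j 1≤j j≤n → ¬>1⇒≡1 (proj₁ sds) 1≤j (none j j≤n)
  ... | inj₂ (r , r≤n , (1≤r , 1<ar) , least) =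
    CrossDivides-scale d (multiples r) (λ m → 𝟙 (r ≤? m)) risingProd-divideOut lcmUpTo-divideOut
      (exponent-inequality 1≤r k≤n n∸k≤k)
      (descent b-IsSDS (smaller (risingProd-decreases r≤n)))
    where
    open DivideOut sds 1≤r 1<ar (λ j 1≤j j<r → ¬>1⇒≡1 (proj₁ sds) 1≤j (least j j<r))

divℕ≡/ : ∀ x y .{{_ : NonZero y}} → divℕ x y ≡ x / y
divℕ≡/ x (suc y) = refl

*∣*⇒∣/* : ∀ {A A′ X F} .{{_ : NonZero A′}} .{{_ : NonZero X}} →
  A′ ∣ A → A * X ∣ F * A′ → A ∣ F / X * A′
*∣*⇒∣/* {A} {A′} {X} {F} A′∣A AX∣FA′ = *-cancelʳ-∣ X (subst (A * X ∣_) FA′≡ AX∣FA′)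
  where
  X∣F : X ∣ F
  X∣F = *-cancelˡ-∣ A′ (∣-trans (*-monoˡ-∣ X A′∣A) (subst (A * X ∣_) (*-comm F A′) AX∣FA′))
  FA′≡ : F * A′ ≡ F / X * A′ * X
  FA′≡ = begin
    F * A′           ≡⟨ cong (_* A′) (sym (m/n*n≡m X∣F)) ⟩
    F / X * X * A′   ≡⟨ *-assoc (F / X) X A′ ⟩
    F / X * (X * A′) ≡⟨ cong (F / X *_) (*-comm X A′) ⟩
    F / X * (A′ * X) ≡⟨ sym (*-assoc (F / X) A′ X) ⟩
    F / X * A′ * X   ∎
    where open ≡-Reasoning

lcmUpTo-∣-aBinom*lcmUpTo : ∀ {a} → IsSDS a → ∀ {n k} → k ≤ n → n ∸ k ≤ k →
  lcmUpTo a n ∣ aBinom a n k * lcmUpTo a k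
lcmUpTo-∣-aBinom*lcmUpTo {a} sds {n} {k} k≤n n∸k≤k =
  subst (λ B → lcmUpTo a n ∣ B * lcmUpTo a k) (sym (divℕ≡/ F X))
    (*∣*⇒∣/* (lcmUpTo-mono-∣ a k≤n) (*-cancelʳ-∣ Y (subst₂ _∣_ lhs rhs cross)))
  where
  F = fallingProd a n k
  X = risingProd a k
  Y = risingProd a (n ∸ k)
  instance
    _ = >-nonZero (risingProd-pos (proj₁ sds) k)
    _ = >-nonZero (risingProd-pos (proj₁ sds) (n ∸ k))
    _ = >-nonZero (lcmUpTo-pos (proj₁ sds) k)
  cross : CrossDivides (risingProd a) (lcmUpTo a) n k
  cross = IsSDS⇒CrossDivides k≤n n∸k≤k sds
  lhs : lcmUpTo a n * (X * Y) ≡ lcmUpTo a n * X * Y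
  lhs = sym (*-assoc (lcmUpTo a n) X Y)
  rhs : risingProd a n * lcmUpTo a k ≡ F * lcmUpTo a k * Y
  rhs = trans (cong (_* lcmUpTo a k) (sym (fallingProd*risingProd a k≤n))) (rearrange F Y (lcmUpTo a k))
    where
    rearrange : ∀ f y l → f * y * l ≡ f * l * y
    rearrange = solve-∀

aBinom-diagonal : ∀ {a} → Positive a → ∀ n → aBinom a n n ≡ 1
aBinom-diagonal {a} pos n = begin
  divℕ (fallingProd a n n) (risingProd a n) ≡⟨ divℕ≡/ _ (risingProd a n) ⟩
  fallingProd a n n / risingProd a n         ≡⟨ cong (_/ risingProd a n) F≡R ⟩
  risingProd a n / risingProd a n            ≡⟨ n/n≡1 (risingProd a n) ⟩
  1                                          ∎
  where
  open ≡-Reasoning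
  instance _ = >-nonZero (risingProd-pos pos n)
  F≡R : fallingProd a n n ≡ risingProd a n
  F≡R = trans (sym (*-identityʳ _)) (subst (λ i → fallingProd a n n * risingProd a i ≡ risingProd a n)
          (n∸n≡0 n) (fallingProd*risingProd a {n} ≤-refl))

m≤2n⇒m∸n≤n : ∀ {m n} → m ≤ 2 * n → m ∸ n ≤ n
m≤2n⇒m∸n≤n {m} {n} m≤2n = m≤n+o⇒m∸n≤o m n (subst (m ≤_) (cong (n +_) (+-identityʳ n)) m≤2n)

gcdTerms-greatest : ∀ {a n x} m → (∀ {k} → k ≤ m → n ≤ 2 * k → x ∣ aBinom a n k * lcmUpTo a k) →
  x ∣ gcdTerms a n m
gcdTerms-greatest {n = n} {x} zero terms with n ≤? 0
... | yes n≤0 = terms z≤n n≤0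
... | no _    = x ∣0
gcdTerms-greatest {n = n} (suc m) terms with n ≤? 2 * suc m
... | yes n≤2k = gcd-greatest (gcdTerms-greatest m (terms ∘ m≤n⇒m≤1+n)) (terms ≤-refl n≤2k)
... | no _     = gcdTerms-greatest m (terms ∘ m≤n⇒m≤1+n)

gcdTerms-∣-last : ∀ {a n} m → n ≤ 2 * m → gcdTerms a n m ∣ aBinom a n m * lcmUpTo a m
gcdTerms-∣-last {n = n} zero n≤0 with n ≤? 0
... | yes _   = ∣-refl
... | no n≰0  = contradiction n≤0 n≰0
gcdTerms-∣-last {a} {n} (suc m) n≤2k with n ≤? 2 * suc m
... | yes _   = gcd[m,n]∣n (gcdTerms a n m) (aBinom a n (suc m) * lcmUpTo a (suc m))
... | no n≰2k = contradiction n≤2k n≰2k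

mainTheorem16 : (a : ℕ → ℕ) → IsSDS a →
    ∀ n → 1 ≤ n → lcmUpTo a n ≡ gcdRHS a n
mainTheorem16 a sds n _ = ∣-antisym
  (gcdTerms-greatest n λ k≤n n≤2k → lcmUpTo-∣-aBinom*lcmUpTo sds k≤n (m≤2n⇒m∸n≤n n≤2k))
  (subst (gcdRHS a n ∣_) last≡ (gcdTerms-∣-last n (m≤m+n n (n + 0))))
  where
  last≡ : aBinom a n n * lcmUpTo a n ≡ lcmUpTo a n
  last≡ = trans (cong (_* lcmUpTo a n) (aBinom-diagonal (proj₁ sds) n)) (*-identityˡ (lcmUpTo a n))
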